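{- Let $G$ be a finite simple graph with $\gamma(G)=k$, and let $G'$ be the graph obtained from $G$ by adding one new isolated vertex. Then $\gamma(G')=k$.
   Context: All graphs are finite, simple and undirected. A graph $G=(V,E)$ is a star-$k$-PCG if there exist a weight function $w:V\to\mathbb{R}^+$ and $k$ pairwise disjoint intervals $I_1,\dots,I_k$ such that for distinct $u,v\in V$, $uv\in E$ if and only if $w(u)+w(v)\in\bigcup_i I_i$. The star number $\gamma(G)$ is the least positive integer $k$ such that $G$ is a star-$k$-PCG.
   Formalization: The weight function $w$ takes values in the positive rationals rather than $\mathbb{R}^+$, and the intervals $I_1,\dots,I_k$ are taken with rational endpoints. -}

module Defs where

open import Data.Nat using (ℕ; zero; suc)
open import Data.Fin using (Fin; zero; suc)
open import Data.Bool using (Bool; true; false)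
open import Data.Rational using (ℚ; 0ℚ; _<_; _≤_; _+_)
open import Data.Product using (Σ; _×_; ∃)
open import Data.Unit using (⊤)
open import Relation.Nullary using (¬_)
open import Relation.Binary.PropositionalEquality using (_≡_)

record SimpleGraph (n : ℕ) : Set where
  field
    adj    : Fin n → Fin n → Bool
    sym    : ∀ u v → adj u v ≡ adj v u
    irrefl : ∀ v → adj v v ≡ false
open SimpleGraph public

data LowerBound : Set where
  -∞     : LowerBound
  closedL : ℚ → LowerBound
  openL   : ℚ → LowerBound

data UpperBound : Set where
  +∞     : UpperBound
  closedU : ℚ → UpperBound
  openU   : ℚ → UpperBound

record Interval : Set where
  constructor interval
  field
    lower : LowerBound
    upper : UpperBound
open Interval public

AboveL : LowerBound → ℚ → Set
AboveL -∞          x = ⊤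
AboveL (closedL a) x = a ≤ x
AboveL (openL a)   x = a < x

BelowU : UpperBound → ℚ → Set
BelowU +∞          x = ⊤
BelowU (closedU b) x = x ≤ b
BelowU (openU b)   x = x < b

_∈I_ : ℚ → Interval → Set
x ∈I I = AboveL (lower I) x × BelowU (upper I) x

IsStarPCG : ∀ {n} → ℕ → SimpleGraph n → Set
IsStarPCG {n} k G =
  Σ (Fin n → ℚ) λ w →
  Σ (Fin k → Interval) λ I →
    (∀ v → 0ℚ < w v)
  × (∀ i j → ¬ (i ≡ j) → ∀ x → ¬ (x ∈I I i × x ∈I I j))
  × (∀ u v → ¬ (u ≡ v) →
       (adj G u v ≡ true → ∃ λ i → (w u + w v) ∈I I i)
     × ((∃ λ i → (w u + w v) ∈I I i) → adj G u v ≡ true))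

StarNumber : ∀ {n} → SimpleGraph n → ℕ → Set
StarNumber G k =
  1 Data.Nat.≤ k × IsStarPCG k G × (∀ m → 1 Data.Nat.≤ m → m Data.Nat.< k → ¬ IsStarPCG m G)

-- G plus one new isolated vertex (the new vertex is zero; old vertex v becomes suc v).
addIsolatedAdj : ∀ {n} → (Fin n → Fin n → Bool) → Fin (suc n) → Fin (suc n) → Bool
addIsolatedAdj a zero    _       = false
addIsolatedAdj a (suc u) zero    = false
addIsolatedAdj a (suc u) (suc v) = a u v

addIsolatedSym : ∀ {n} (G : SimpleGraph n) → ∀ u v →
  addIsolatedAdj (adj G) u v ≡ addIsolatedAdj (adj G) v u
addIsolatedSym G zero    zero    = Relation.Binary.PropositionalEquality.refl
addIsolatedSym G zero    (suc v) = Relation.Binary.PropositionalEquality.refl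
addIsolatedSym G (suc u) zero    = Relation.Binary.PropositionalEquality.refl
addIsolatedSym G (suc u) (suc v) = sym G u v

addIsolatedIrrefl : ∀ {n} (G : SimpleGraph n) → ∀ v → addIsolatedAdj (adj G) v v ≡ false
addIsolatedIrrefl G zero    = Relation.Binary.PropositionalEquality.refl
addIsolatedIrrefl G (suc v) = irrefl G v

addIsolated : ∀ {n} → SimpleGraph n → SimpleGraph (suc n)
addIsolated G = record
  { adj = addIsolatedAdj (adj G)
  ; sym = addIsolatedSym G
  ; irrefl = addIsolatedIrrefl G }

{-# OPTIONS --safe #-}
module Submission where

open import Defs
open import Data.Nat using (ℕ; suc)
open import Data.Fin using (Fin; zero; suc)
open import Data.Fin.Properties using (suc-injective)
open import Data.Bool using (true)
open import Data.Rational using (ℚ; 0ℚ; 1ℚ; _<_; _≤_; _+_; _⊓_)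
open import Data.Rational.Properties
open import Data.List using (tabulate)
open import Data.List.Relation.Unary.All.Properties using (tabulate⁻)
import Data.List.Extrema
open import Data.Product using (_×_; ∃; _,_; proj₁)
open import Data.Sum using (inj₁; inj₂)
open import Data.Unit using (tt)
open import Function using (_∘_)
open import Function.Definitions using (Injective)
open import Relation.Binary.Bundles using (DecTotalOrder)
open import Relation.Nullary using (¬_; contradiction)
open import Relation.Binary.PropositionalEquality using (_≡_; _≢_; refl; cong; subst)

open Data.List.Extrema (DecTotalOrder.totalOrder ≤-decTotalOrder) using (max; xs≤max; ⊥≤max)

-- Deleting vertices keeps a representation, so γ(G') ≥ γ(G). Conversely, given a
-- representation of G, pick T > 0 above every weight sum w u + w v and cut every interval
-- off at T. The old sums are below T, so the old edges are still represented; giving the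
-- new vertex weight T makes each of its sums exceed T, so it is isolated. Hence γ(G') ≤ γ(G).

InUnion : ∀ {k} → (Fin k → Interval) → ℚ → Set
InUnion I x = ∃ λ i → x ∈I I i

PairwiseDisjoint : ∀ {k} → (Fin k → Interval) → Set
PairwiseDisjoint I = ∀ i j → ¬ (i ≡ j) → ∀ x → ¬ (x ∈I I i × x ∈I I j)

p<p+q : ∀ p {q} → 0ℚ < q → p < p + q
p<p+q p {q} 0<q = subst (_< p + q) (+-identityʳ p) (+-monoʳ-< p 0<q)

p<q+p : ∀ p {q} → 0ℚ < q → p < q + p
p<q+p p {q} 0<q = subst (p <_) (+-comm p q) (p<p+q p 0<q)

p≤q⇒p<q+1 : ∀ {p q} → p ≤ q → p < q + 1ℚ
p≤q⇒p<q+1 {p} {q} p≤q = subst (_< q + 1ℚ) (+-identityʳ p) (+-mono-≤-< p≤q (positive⁻¹ 1ℚ))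

p<q⇒p<r⇒p<q⊓r : ∀ {p q r} → p < q → p < r → p < q ⊓ r
p<q⇒p<r⇒p<q⊓r {p} {q} {r} p<q p<r with ⊓-sel q r
... | inj₁ q⊓r≡q rewrite q⊓r≡q = p<q
... | inj₂ q⊓r≡r rewrite q⊓r≡r = p<r

pairSums-bounded : ∀ {n} (w : Fin n → ℚ) → ∃ λ T → 0ℚ < T × (∀ u v → w u + w v < T)
pairSums-bounded w = (B + B) + 1ℚ , p≤q⇒p<q+1 (+-mono-≤ 0≤B 0≤B) , sum<T
  where
  B : ℚ
  B = max 0ℚ (tabulate w)

  0≤B : 0ℚ ≤ B
  0≤B = ⊥≤max 0ℚ (tabulate w)

  w≤B : ∀ v → w v ≤ B
  w≤B = tabulate⁻ (xs≤max 0ℚ (tabulate w))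

  sum<T : ∀ u v → w u + w v < (B + B) + 1ℚ
  sum<T u v = p≤q⇒p<q+1 (+-mono-≤ (w≤B u) (w≤B v))

isStarPCG-induced : ∀ {m n k} (G : SimpleGraph m) (H : SimpleGraph n) (f : Fin m → Fin n) →
  Injective _≡_ _≡_ f → (∀ u v → adj G u v ≡ adj H (f u) (f v)) →
  IsStarPCG k H → IsStarPCG k G
isStarPCG-induced G H f f-inj f-adj (w , I , pos , disj , rep) =
  w ∘ f , I , pos ∘ f , disj , rep′
  where
  rep′ : ∀ u v → u ≢ v →
    (adj G u v ≡ true → InUnion I (w (f u) + w (f v))) ×
    (InUnion I (w (f u) + w (f v)) → adj G u v ≡ true)
  rep′ u v u≢v rewrite f-adj u v = rep (f u) (f v) (u≢v ∘ f-inj)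

isStarPCG-addIsolated⁻ : ∀ {n k} (G : SimpleGraph n) → IsStarPCG k (addIsolated G) → IsStarPCG k G
isStarPCG-addIsolated⁻ G = isStarPCG-induced G (addIsolated G) suc suc-injective (λ _ _ → refl)

capU : ℚ → UpperBound → UpperBound
capU T +∞          = closedU T
capU T (closedU b) = closedU (b ⊓ T)
capU T (openU b)   = openU (b ⊓ T)

BelowU-capU⁻ : ∀ T u {x} → BelowU (capU T u) x → BelowU u x × x ≤ T
BelowU-capU⁻ T +∞          x≤T   = tt , x≤T
BelowU-capU⁻ T (closedU b) x≤b⊓T = p≤q⊓r⇒p≤q b T x≤b⊓T , p≤q⊓r⇒p≤r b T x≤b⊓T
BelowU-capU⁻ T (openU b)   x<b⊓T =
  <-≤-trans x<b⊓T (p⊓q≤p b T) , <⇒≤ (<-≤-trans x<b⊓T (p⊓q≤q b T))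

BelowU-capU⁺ : ∀ T u {x} → BelowU u x → x < T → BelowU (capU T u) x
BelowU-capU⁺ T +∞          _   x<T = <⇒≤ x<T
BelowU-capU⁺ T (closedU b) x≤b x<T = ⊓-glb x≤b (<⇒≤ x<T)
BelowU-capU⁺ T (openU b)   x<b x<T = p<q⇒p<r⇒p<q⊓r x<b x<T

capI : ℚ → Interval → Interval
capI T (interval l u) = interval l (capU T u)

∈-capI⁻ : ∀ T I {x} → x ∈I capI T I → x ∈I I × x ≤ T
∈-capI⁻ T (interval l u) (x≥l , x≤cap) with BelowU-capU⁻ T u x≤cap
... | x≤u , x≤T = (x≥l , x≤u) , x≤T

∈-capI⁺ : ∀ T I {x} → x ∈I I → x < T → x ∈I capI T I
∈-capI⁺ T (interval l u) (x≥l , x≤u) x<T = x≥l , BelowU-capU⁺ T u x≤u x<T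

module _ {k} (T : ℚ) (I : Fin k → Interval) where

  capI-disjoint : PairwiseDisjoint I → PairwiseDisjoint (capI T ∘ I)
  capI-disjoint disj i j i≢j x (x∈i , x∈j) =
    disj i j i≢j x (proj₁ (∈-capI⁻ T (I i) x∈i) , proj₁ (∈-capI⁻ T (I j) x∈j))

  inUnion-capI⁻ : ∀ {x} → InUnion (capI T ∘ I) x → InUnion I x
  inUnion-capI⁻ (i , x∈i) with ∈-capI⁻ T (I i) x∈i
  ... | x∈Ii , _ = i , x∈Ii

  inUnion-capI⁺ : ∀ {x} → InUnion I x → x < T → InUnion (capI T ∘ I) x
  inUnion-capI⁺ (i , x∈i) x<T = i , ∈-capI⁺ T (I i) x∈i x<T

  ∉-capI : ∀ {x} → T < x → ¬ InUnion (capI T ∘ I) x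
  ∉-capI T<x (i , x∈i) with ∈-capI⁻ T (I i) x∈i
  ... | _ , x≤T = <-irrefl refl (<-≤-trans T<x x≤T)

isStarPCG-addIsolated⁺ : ∀ {n k} (G : SimpleGraph n) → IsStarPCG k G → IsStarPCG k (addIsolated G)
isStarPCG-addIsolated⁺ {n} G (w , I , pos , disj , rep) with pairSums-bounded w
... | T , 0<T , sum<T = w′ , capI T ∘ I , pos′ , capI-disjoint T I disj , rep′
  where
  w′ : Fin (suc n) → ℚ
  w′ zero    = T
  w′ (suc v) = w v

  pos′ : ∀ v → 0ℚ < w′ v
  pos′ zero    = 0<T
  pos′ (suc v) = pos v

  rep′ : ∀ u v → u ≢ v →
    (adj (addIsolated G) u v ≡ true → InUnion (capI T ∘ I) (w′ u + w′ v)) ×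
    (InUnion (capI T ∘ I) (w′ u + w′ v) → adj (addIsolated G) u v ≡ true)
  rep′ zero    zero    0≢0 = contradiction refl 0≢0
  rep′ zero    (suc v) _   = (λ ()) , λ x∈ → contradiction x∈ (∉-capI T I (p<p+q T (pos v)))
  rep′ (suc u) zero    _   = (λ ()) , λ x∈ → contradiction x∈ (∉-capI T I (p<q+p T (pos u)))
  rep′ (suc u) (suc v) u≢v with rep u v (u≢v ∘ cong suc)
  ... | edge⇒∈ , ∈⇒edge =
    (λ e → inUnion-capI⁺ T I (edge⇒∈ e) (sum<T u v)) , ∈⇒edge ∘ inUnion-capI⁻ T I

theorem2 : ∀ {n : ℕ} (G : SimpleGraph n) (k : ℕ) →
    StarNumber G k → StarNumber (addIsolated G) k
theorem2 G k (1≤k , pcg , minimal) =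
  1≤k , isStarPCG-addIsolated⁺ G pcg ,
  λ m 1≤m m<k → minimal m 1≤m m<k ∘ isStarPCG-addIsolated⁻ G
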